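{- Let $g=2n$ with $n$ a positive integer, let $Q=\prod_{q\mid 2n,\ q\text{ prime}} q$ be the product of the distinct primes dividing $2n$ (including 2), and let $\bar q$ be the largest prime factor of $Q$. Then $$\sum_{j\ge1} n_{g,j}(\bar q\#)=\varphi(Q)\cdot\prod_{p<\bar q,\ p\text{ prime},\ p\nmid Q}(p-2),$$ and in particular the gap $g$ has driving terms in $\mathcal{G}(\bar q\#)$.
   Context: For a prime $p$, $p\#$ denotes the product of all primes $\le p$. For a positive integer $N$, let $1=u_0<\dots<u_{\varphi(N)}=N+1$ be the integers in $[1,N+1]$ coprime to $N$, and $\mathcal{G}(N)=(g_1,\dots,g_{\varphi(N)})$, $g_i=u_i-u_{i-1}$, indices cyclic mod $\varphi(N)$. For $j\ge1$, a driving term of length $j$ for the gap $g$ is a position $i\in\{1,\dots,\varphi(N)\}$ with $g_i+\dots+g_{i+j-1}=g$, and $n_{g,j}(N)$ is the number of them. $\varphi$ is Euler's totient function. -}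

module Defs where

open import Data.Nat using (ℕ; zero; suc; _+_; _*_; _∸_; _<_; _≤_; _%_)
open import Data.Nat.Properties using (_≤?_; _<?_; _≟_)
open import Data.Nat.Divisibility using (_∣_; _∣?_)
open import Data.Nat.Coprimality using (Coprime; coprime?)
open import Data.Nat.Primality using (Prime; prime?)
open import Data.List using (List; []; _∷_; filter; map; upTo; length)
open import Data.Nat.ListAction using (sum; product)
open import Relation.Nullary using (¬_; ¬?)
open import Relation.Nullary.Decidable using (_×-dec_)
open import Data.Product using (_×_)

interval : ℕ → ℕ → List ℕ
interval a b = map (λ k → a + k) (upTo (suc b ∸ a))

φ : ℕ → ℕ
φ N = length (filter (λ k → coprime? k N) (interval 1 N))

primesUpTo : ℕ → List ℕ
primesUpTo p = filter prime? (interval 1 p)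

_# : ℕ → ℕ
p # = product (primesUpTo p)

-- u_0 < u_1 < ... : integers in [1, N+1] coprime to N
units : ℕ → List ℕ
units N = filter (λ k → coprime? k N) (interval 1 (suc N))

diffs : List ℕ → List ℕ
diffs []           = []
diffs (x ∷ [])     = []
diffs (x ∷ y ∷ xs) = (y ∸ x) ∷ diffs (y ∷ xs)

gapList : ℕ → List ℕ
gapList N = diffs (units N)

-- k-th element (0-based), default 0
nth : List ℕ → ℕ → ℕ
nth []       _       = 0
nth (x ∷ xs) zero    = x
nth (x ∷ xs) (suc k) = nth xs k

modL : ℕ → ℕ → ℕ
modL i zero    = 0
modL i (suc m) = i % suc m

-- g_i for i ≥ 1, indices cyclic modulo the length of G(N)
gap : ℕ → ℕ → ℕ
gap N i = nth (gapList N) (modL (i ∸ 1) (length (gapList N)))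

windowSum : ℕ → ℕ → ℕ → ℕ
windowSum N i j = sum (map (λ t → gap N (i + t)) (upTo j))

drivingCount : ℕ → ℕ → ℕ → ℕ
drivingCount g j N =
  length (filter (λ i → windowSum N i j ≟ g) (interval 1 (length (gapList N))))

primeDivisors : ℕ → List ℕ
primeDivisors m = filter (λ q → prime? q ×-dec q ∣? m) (interval 1 m)

radical : ℕ → ℕ
radical m = product (primeDivisors m)

oddFactor : ℕ → ℕ → ℕ
oddFactor qb Q =
  product (map (λ p → p ∸ 2)
    (filter (λ p → prime? p ×-dec ¬? (p ∣? Q)) (interval 1 (qb ∸ 1))))

partialDrivingSum : ℕ → ℕ → ℕ → ℕ
partialDrivingSum g N J = sum (map (λ j → drivingCount g j N) (interval 1 J))

{-# OPTIONS --safe #-}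
-- Let N = q̄#. Continue the units 1 = u₀ < u₁ < ⋯ of N periodically by u_{k+φ(N)} = u_k + N;
-- then 𝒢(N) is the sequence of differences of the u_k, and every positive integer coprime
-- to N is some u_k. A window of j gaps starting at u_k sums to g exactly when u_{k+j} = u_k + g,
-- and as gaps are positive such a window has j ≤ g. So once J ≥ g every starting position
-- contributes one driving term if u_k + g is coprime to N and none otherwise: the partial sums
-- stabilise at #{x mod N : gcd(x (x + g), N) = 1}. By the Chinese remainder theorem this is
-- ∏_{p ≤ q̄} (p − 1 or p − 2, according as p ∣ g or not). The primes p ≤ q̄ dividing g are exactly
-- the primes dividing Q, and their factors p − 1 multiply to φ(Q); the others are the primes
-- p < q̄ with p ∤ Q. Since 2 ∣ g no factor vanishes, so g has driving terms.
module Submission where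

open import Defs
open import Algebra.Bundles using (CommutativeMonoid)
import Algebra.Properties.CommutativeSemigroup as CommutativeSemigroupProperties
open import Data.Bool using (Bool; true; false; _∧_; not; if_then_else_)
open import Data.Bool.Properties using (∧-commutativeMonoid; ∧-idem; ∧-comm)
open import Data.Empty using (⊥-elim)
open import Data.List using (List; []; _∷_; _++_; _∷ʳ_; filter; map; upTo; applyUpTo; length)
open import Data.List.Membership.Propositional using (_∈_)
open import Data.List.Membership.Propositional.Properties using (∈-filter⁺; ∈-filter⁻)
open import Data.List.Properties using (map-∘; map-id; map-cong-local; filter-++; filter-accept; filter-none; filter-≐; ++-identityʳ; length-++)
open import Data.List.Relation.Unary.All as All using (All; []; _∷_)
import Data.List.Relation.Unary.All.Properties as All
open import Data.List.Relation.Unary.AllPairs as AllPairs using (AllPairs; []; _∷_)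
import Data.List.Relation.Unary.AllPairs.Properties as AllPairs
open import Data.List.Relation.Unary.Any using (here; there)
open import Data.Nat using (ℕ; zero; suc; _+_; _*_; _∸_; _≤_; _<_; _≥_; z≤n; s≤s; _%_; _/_)
open import Data.Nat using (>-nonZero; nonTrivial⇒n>1; nonTrivial⇒nonZero; nonTrivial⇒≢1)
open import Data.Nat.Properties
open import Data.Nat.ListAction using (sum; product)
open import Data.Nat.ListAction.Properties using (∈⇒∣product)
open import Data.Nat.Coprimality using (Coprime; coprime?; coprime-Bézout; coprime-divisor; 1-coprimeTo)
open import Data.Nat.Divisibility
open import Data.Nat.DivMod using (m≡m%n+[m/n]*n; m%n<n; [m+kn]%n≡m%n; m<n⇒m%n≡m)
import Data.Nat.GCD as GCD
open import Data.Nat.Primality using (Prime; prime?; euclidsLemma; prime⇒irreducible; prime⇒nonTrivial; productOfPrimes≥1)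
open import Data.Nat.Tactic.RingSolver using (solve-∀)
open import Data.Product using (_×_; ∃-syntax; _,_; proj₁; proj₂)
open import Data.Sum using (inj₁; inj₂)
open import Relation.Binary.Definitions using (tri<; tri≈; tri>)
open import Function using (_∘_)
open import Function.Bundles using (mk⇔; _⇔_; Equivalence)
open import Relation.Nullary using (¬_; Dec; yes; no; does)
open import Relation.Nullary.Decidable using (dec-true; dec-false; does-⇔; _×-dec_; ¬?)
open import Relation.Binary.PropositionalEquality

open CommutativeSemigroupProperties +-commutativeSemigroup using () renaming (interchange to +-interchange)
open CommutativeSemigroupProperties (CommutativeMonoid.commutativeSemigroup ∧-commutativeMonoid)
  using () renaming (interchange to ∧-interchange)

∑ : List ℕ → (ℕ → ℕ) → ℕ
∑ []       f = 0
∑ (x ∷ xs) f = f x + ∑ xs f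

sum-map≡∑ : ∀ (f : ℕ → ℕ) xs → sum (map f xs) ≡ ∑ xs f
sum-map≡∑ f []       = refl
sum-map≡∑ f (x ∷ xs) = cong (f x +_) (sum-map≡∑ f xs)

∑-++ : ∀ xs ys (f : ℕ → ℕ) → ∑ (xs ++ ys) f ≡ ∑ xs f + ∑ ys f
∑-++ []       ys f = refl
∑-++ (x ∷ xs) ys f = trans (cong (f x +_) (∑-++ xs ys f)) (sym (+-assoc (f x) _ _))

∑-map : ∀ (g : ℕ → ℕ) xs (f : ℕ → ℕ) → ∑ (map g xs) f ≡ ∑ xs (f ∘ g)
∑-map g []       f = refl
∑-map g (x ∷ xs) f = cong (f (g x) +_) (∑-map g xs f)

∑-cong : ∀ {f g : ℕ → ℕ} xs → (∀ {x} → x ∈ xs → f x ≡ g x) → ∑ xs f ≡ ∑ xs g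
∑-cong []       f≗g = refl
∑-cong (x ∷ xs) f≗g = cong₂ _+_ (f≗g (here refl)) (∑-cong xs (f≗g ∘ there))

∑-zero : ∀ {f : ℕ → ℕ} xs → (∀ {x} → x ∈ xs → f x ≡ 0) → ∑ xs f ≡ 0
∑-zero []       f≗0 = refl
∑-zero (x ∷ xs) f≗0 = cong₂ _+_ (f≗0 (here refl)) (∑-zero xs (f≗0 ∘ there))

∑-distrib-+ : ∀ xs (f g : ℕ → ℕ) → ∑ xs (λ x → f x + g x) ≡ ∑ xs f + ∑ xs g
∑-distrib-+ []       f g = refl
∑-distrib-+ (x ∷ xs) f g =
  trans (cong (f x + g x +_) (∑-distrib-+ xs f g)) (+-interchange (f x) (g x) (∑ xs f) (∑ xs g))

∑-*ˡ : ∀ c xs (f : ℕ → ℕ) → ∑ xs (λ x → c * f x) ≡ c * ∑ xs f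
∑-*ˡ c []       f = sym (*-zeroʳ c)
∑-*ˡ c (x ∷ xs) f = trans (cong (c * f x +_) (∑-*ˡ c xs f)) (sym (*-distribˡ-+ c (f x) (∑ xs f)))

∑-comm : ∀ xs ys (f : ℕ → ℕ → ℕ) → ∑ xs (λ x → ∑ ys (f x)) ≡ ∑ ys (λ y → ∑ xs (λ x → f x y))
∑-comm []       ys f = sym (∑-zero ys (λ _ → refl))
∑-comm (x ∷ xs) ys f = trans (cong (∑ ys (f x) +_) (∑-comm xs ys f))
                             (sym (∑-distrib-+ ys (f x) (λ y → ∑ xs (λ x → f x y))))

∑-pos⇒∃ : ∀ xs (f : ℕ → ℕ) → 1 ≤ ∑ xs f → ∃[ x ] (x ∈ xs × 1 ≤ f x)
∑-pos⇒∃ (x ∷ xs) f pos with f x in fx≡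
... | suc _ = x , here refl , subst (1 ≤_) (sym fx≡) (s≤s z≤n)
... | zero with ∑-pos⇒∃ xs f pos
...   | y , y∈xs , fy≥1 = y , there y∈xs , fy≥1

boolToℕ : Bool → ℕ
boolToℕ true  = 1
boolToℕ false = 0

boolToℕ-∧ : ∀ a b → boolToℕ (a ∧ b) ≡ boolToℕ a * boolToℕ b
boolToℕ-∧ true  b = sym (+-identityʳ (boolToℕ b))
boolToℕ-∧ false b = refl

countᵇ : (ℕ → Bool) → List ℕ → ℕ
countᵇ f xs = ∑ xs (boolToℕ ∘ f)

length-filter≡countᵇ : ∀ {P : ℕ → Set} (P? : ∀ x → Dec (P x)) xs →
  length (filter P? xs) ≡ countᵇ (does ∘ P?) xs
length-filter≡countᵇ P? []       = refl
length-filter≡countᵇ P? (x ∷ xs) with does (P? x)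
... | true  = cong suc (length-filter≡countᵇ P? xs)
... | false = length-filter≡countᵇ P? xs

countᵇ-filter : ∀ {P : ℕ → Set} (P? : ∀ x → Dec (P x)) (f : ℕ → Bool) xs →
  countᵇ f (filter P? xs) ≡ countᵇ (λ x → does (P? x) ∧ f x) xs
countᵇ-filter P? f []       = refl
countᵇ-filter P? f (x ∷ xs) with does (P? x)
... | true  = cong (boolToℕ (f x) +_) (countᵇ-filter P? f xs)
... | false = countᵇ-filter P? f xs

countᵇ-cong : ∀ {f g : ℕ → Bool} xs → (∀ {x} → x ∈ xs → f x ≡ g x) → countᵇ f xs ≡ countᵇ g xs
countᵇ-cong xs f≗g = ∑-cong xs (cong boolToℕ ∘ f≗g)

countᵇ-none : ∀ {f : ℕ → Bool} xs → (∀ {x} → x ∈ xs → f x ≡ false) → countᵇ f xs ≡ 0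
countᵇ-none xs f≗false = ∑-zero xs (cong boolToℕ ∘ f≗false)

countᵇ-not+countᵇ : ∀ (f : ℕ → Bool) xs → countᵇ (not ∘ f) xs + countᵇ f xs ≡ length xs
countᵇ-not+countᵇ f []       = refl
countᵇ-not+countᵇ f (x ∷ xs) with f x
... | true  = trans (+-suc (countᵇ (not ∘ f) xs) (countᵇ f xs)) (cong suc (countᵇ-not+countᵇ f xs))
... | false = cong suc (countᵇ-not+countᵇ f xs)

countᵇ-neither+countᵇ+countᵇ : ∀ (f g : ℕ → Bool) xs → (∀ x → f x ∧ g x ≡ false) →
  countᵇ (λ x → not (f x) ∧ not (g x)) xs + countᵇ f xs + countᵇ g xs ≡ length xs
countᵇ-neither+countᵇ+countᵇ f g []       disjoint = refl
countᵇ-neither+countᵇ+countᵇ f g (x ∷ xs) disjoint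
  with f x | g x | disjoint x | countᵇ-neither+countᵇ+countᵇ f g xs disjoint
... | true  | true  | () | _
... | true  | false | _  | ih = trans (cong (_+ countᵇ g xs) (+-suc (countᵇ (λ x → not (f x) ∧ not (g x)) xs) (countᵇ f xs))) (cong suc ih)
... | false | true  | _  | ih = trans (+-suc (countᵇ (λ x → not (f x) ∧ not (g x)) xs + countᵇ f xs) (countᵇ g xs)) (cong suc ih)
... | false | false | _  | ih = cong suc ih

range : ℕ → ℕ → List ℕ
range a zero    = []
range a (suc k) = a ∷ range (suc a) k

length-range : ∀ a k → length (range a k) ≡ k
length-range a zero    = refl
length-range a (suc k) = cong suc (length-range (suc a) k)

map-+-range : ∀ c a k → map (c +_) (range a k) ≡ range (c + a) k
map-+-range c a zero    = refl
map-+-range c a (suc k) = cong (c + a ∷_) (trans (map-+-range c (suc a) k) (cong (λ b → range b k) (+-suc c a)))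

map-suc-range : ∀ a k → map suc (range a k) ≡ range (suc a) k
map-suc-range = map-+-range 1

applyUpTo≡map-range : ∀ (f : ℕ → ℕ) k → applyUpTo f k ≡ map f (range 0 k)
applyUpTo≡map-range f zero    = refl
applyUpTo≡map-range f (suc k) = cong (f 0 ∷_) (begin
  applyUpTo (f ∘ suc) k         ≡⟨ applyUpTo≡map-range (f ∘ suc) k ⟩
  map (f ∘ suc) (range 0 k)     ≡⟨ map-∘ (range 0 k) ⟩
  map f (map suc (range 0 k))   ≡⟨ cong (map f) (map-suc-range 0 k) ⟩
  map f (range 1 k)             ∎)
  where open ≡-Reasoning

upTo≡range : ∀ k → upTo k ≡ range 0 k
upTo≡range k = trans (applyUpTo≡map-range (λ x → x) k) (map-id (range 0 k))

interval≡range : ∀ a b → interval a b ≡ range a (suc b ∸ a)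
interval≡range a b = begin
  map (a +_) (upTo (suc b ∸ a))      ≡⟨ cong (map (a +_)) (upTo≡range (suc b ∸ a)) ⟩
  map (a +_) (range 0 (suc b ∸ a))   ≡⟨ map-+-range a 0 (suc b ∸ a) ⟩
  range (a + 0) (suc b ∸ a)          ≡⟨ cong (λ c → range c (suc b ∸ a)) (+-identityʳ a) ⟩
  range a (suc b ∸ a)                ∎
  where open ≡-Reasoning

range-++ : ∀ a k l → range a (k + l) ≡ range a k ++ range (a + k) l
range-++ a zero    l = cong (λ c → range c l) (sym (+-identityʳ a))
range-++ a (suc k) l = cong (a ∷_) (trans (range-++ (suc a) k l) (cong (λ c → range (suc a) k ++ range c l) (sym (+-suc a k))))

range-∷ʳ : ∀ a k → range a (suc k) ≡ range a k ∷ʳ (a + k)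
range-∷ʳ a k = trans (cong (range a) (+-comm 1 k)) (range-++ a k 1)

∈-range⁻ : ∀ {x} a k → x ∈ range a k → a ≤ x × x < a + k
∈-range⁻ a (suc k) (here refl) = ≤-refl , m<m+n a (s≤s z≤n)
∈-range⁻ {x} a (suc k) (there x∈) with ∈-range⁻ (suc a) k x∈
... | a<x , x<a+k = <⇒≤ a<x , subst (x <_) (sym (+-suc a k)) x<a+k

∈-range⁺ : ∀ {x} a k → a ≤ x → x < a + k → x ∈ range a k
∈-range⁺ {x} a zero    a≤x x<a+0 = ⊥-elim (<-irrefl refl (<-≤-trans x<a+0 (subst (_≤ x) (sym (+-identityʳ a)) a≤x)))
∈-range⁺ {x} a (suc k) a≤x x<a+k with m≤n⇒m<n∨m≡n a≤x
... | inj₂ refl = here refl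
... | inj₁ a<x  = there (∈-range⁺ (suc a) k a<x (subst (x <_) (+-suc a k) x<a+k))

range-increasing : ∀ a k → AllPairs _<_ (range a k)
range-increasing a zero    = []
range-increasing a (suc k) = All.tabulate (proj₁ ∘ ∈-range⁻ (suc a) k) ∷ range-increasing (suc a) k

countᵇ-range-unique : ∀ (f : ℕ → Bool) a k {w} → w ∈ range a k → f w ≡ true →
  (∀ {t} → t ∈ range a k → f t ≡ true → t ≡ w) → countᵇ f (range a k) ≡ 1
countᵇ-range-unique f a (suc k) (here refl) fa unique =
  cong₂ _+_ (cong boolToℕ fa) (countᵇ-none (range (suc a) k) rest-false)
  where
  rest-false : ∀ {t} → t ∈ range (suc a) k → f t ≡ false
  rest-false {t} t∈ with f t in ft
  ... | false = refl
  ... | true  = ⊥-elim (<-irrefl (sym (unique (there t∈) ft)) (proj₁ (∈-range⁻ (suc a) k t∈)))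
countᵇ-range-unique f a (suc k) {w} (there w∈) fw unique =
  cong₂ _+_ (cong boolToℕ a-false) (countᵇ-range-unique f (suc a) k w∈ fw (unique ∘ there))
  where
  a-false : f a ≡ false
  a-false with f a in fa
  ... | false = refl
  ... | true  = ⊥-elim (<-irrefl (unique (here refl) fa) (proj₁ (∈-range⁻ (suc a) k w∈)))

nth-++ˡ : ∀ xs ys {i} → i < length xs → nth (xs ++ ys) i ≡ nth xs i
nth-++ˡ (x ∷ xs) ys {zero}  _         = refl
nth-++ˡ (x ∷ xs) ys {suc i} (s≤s i<n) = nth-++ˡ xs ys i<n

nth-length-∷ʳ : ∀ xs y → nth (xs ∷ʳ y) (length xs) ≡ y
nth-length-∷ʳ []       y = refl
nth-length-∷ʳ (x ∷ xs) y = nth-length-∷ʳ xs y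

nth-∈ : ∀ xs {i} → i < length xs → nth xs i ∈ xs
nth-∈ (x ∷ xs) {zero}  _         = here refl
nth-∈ (x ∷ xs) {suc i} (s≤s i<n) = there (nth-∈ xs i<n)

∈⇒nth : ∀ {x} xs → x ∈ xs → ∃[ i ] (i < length xs × nth xs i ≡ x)
∈⇒nth (y ∷ xs) (here refl) = 0 , s≤s z≤n , refl
∈⇒nth (y ∷ xs) (there x∈) with ∈⇒nth xs x∈
... | i , i<n , xsᵢ≡x = suc i , s≤s i<n , xsᵢ≡x

map-nth-range : ∀ xs → map (nth xs) (range 0 (length xs)) ≡ xs
map-nth-range []       = refl
map-nth-range (x ∷ xs) = cong (x ∷_) (begin
  map (nth (x ∷ xs)) (range 1 (length xs))          ≡⟨ cong (map (nth (x ∷ xs))) (map-suc-range 0 (length xs)) ⟨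
  map (nth (x ∷ xs)) (map suc (range 0 (length xs))) ≡⟨ map-∘ (range 0 (length xs)) ⟨
  map (nth xs) (range 0 (length xs))                 ≡⟨ map-nth-range xs ⟩
  xs                                                 ∎)
  where open ≡-Reasoning

nth-increasing : ∀ {xs} → AllPairs _<_ xs → ∀ {i} → suc i < length xs → nth xs i < nth xs (suc i)
nth-increasing ([] ∷ _)           (s≤s ())
nth-increasing ((x<y ∷ _) ∷ _)    {zero}  _           = x<y
nth-increasing (_ ∷ ys↑@(_ ∷ _))  {suc i} (s≤s i+1<n) = nth-increasing ys↑ i+1<n

length-diffs : ∀ x xs → length (diffs (x ∷ xs)) ≡ length xs
length-diffs x []       = refl
length-diffs x (y ∷ xs) = cong suc (length-diffs y xs)

nth-diffs : ∀ xs {i} → suc i < length xs → nth (diffs xs) i ≡ nth xs (suc i) ∸ nth xs i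
nth-diffs (x ∷ [])     (s≤s ())
nth-diffs (x ∷ y ∷ xs) {zero}  _           = refl
nth-diffs (x ∷ y ∷ xs) {suc i} (s≤s i+1<n) = nth-diffs (y ∷ xs) i+1<n

-- Coprimality and linear congruences

m+n≡o⇒m≡o∸n : ∀ {m n o} → m + n ≡ o → m ≡ o ∸ n
m+n≡o⇒m≡o∸n {m} {n} refl = sym (m+n∸n≡m m n)

∣m+n∣n⇒∣m : ∀ {d m n} → d ∣ m + n → d ∣ n → d ∣ m
∣m+n∣n⇒∣m {d} {m} {n} d∣m+n = ∣m+n∣m⇒∣n (subst (d ∣_) (+-comm m n) d∣m+n)

∣∧<⇒≡0 : ∀ {p d} → p ∣ d → d < p → d ≡ 0
∣∧<⇒≡0 {d = zero}  _   _   = refl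
∣∧<⇒≡0 {d = suc _} p∣d d<p = ⊥-elim (<⇒≱ d<p (∣⇒≤ p∣d))

_∣ᵇ_ : ℕ → ℕ → Bool
d ∣ᵇ n = does (d ∣? n)

coprimeᵇ : ℕ → ℕ → Bool
coprimeᵇ x n = does (coprime? x n)

does-true⇒ : ∀ {A : Set} (a? : Dec A) → does a? ≡ true → A
does-true⇒ (yes a) _ = a

prime≥2 : ∀ {p} → Prime p → 2 ≤ p
prime≥2 {p} pp = nonTrivial⇒n>1 p {{prime⇒nonTrivial pp}}

prime≢1 : ∀ {p} → Prime p → p ≢ 1
prime≢1 pp = nonTrivial⇒≢1 {{prime⇒nonTrivial pp}}

coprime-*⁻ : ∀ {x a b} → Coprime x (a * b) → Coprime x a × Coprime x b
coprime-*⁻ {a = a} {b} c = (λ (d∣x , d∣a) → c (d∣x , ∣m⇒∣m*n b d∣a))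
                        , (λ (d∣x , d∣b) → c (d∣x , ∣n⇒∣m*n a d∣b))

coprime-*⁺ : ∀ {x a b} → Coprime x a → Coprime x b → Coprime x (a * b)
coprime-*⁺ ca cb (d∣x , d∣ab) = cb (d∣x , coprime-divisor (λ (e∣d , e∣a) → ca (∣-trans e∣d d∣x , e∣a)) d∣ab)

coprime-+*⁻ : ∀ t {n y} → Coprime (t * n + y) n → Coprime y n
coprime-+*⁻ t c (d∣y , d∣n) = c (∣m∣n⇒∣m+n (∣n⇒∣m*n t d∣n) d∣y , d∣n)

coprime-+*⁺ : ∀ t {n y} → Coprime y n → Coprime (t * n + y) n
coprime-+*⁺ t c (d∣ty , d∣n) = c (∣m+n∣m⇒∣n d∣ty (∣n⇒∣m*n t d∣n) , d∣n)

coprime-prime⁻ : ∀ {x p} → Prime p → Coprime x p → ¬ p ∣ x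
coprime-prime⁻ pp c p∣x = prime≢1 pp (c (p∣x , ∣-refl))

coprime-prime⁺ : ∀ {x p} → Prime p → ¬ p ∣ x → Coprime x p
coprime-prime⁺ pp p∤x (d∣x , d∣p) with prime⇒irreducible pp d∣p
... | inj₁ d≡1 = d≡1
... | inj₂ refl = ⊥-elim (p∤x d∣x)

coprimeᵇ-* : ∀ x a b → coprimeᵇ x (a * b) ≡ coprimeᵇ x a ∧ coprimeᵇ x b
coprimeᵇ-* x a b = does-⇔ (mk⇔ coprime-*⁻ (λ (ca , cb) → coprime-*⁺ ca cb))
  (coprime? x (a * b)) (coprime? x a ×-dec coprime? x b)

coprimeᵇ-+* : ∀ t n y → coprimeᵇ (t * n + y) n ≡ coprimeᵇ y n
coprimeᵇ-+* t n y = does-⇔ (mk⇔ (coprime-+*⁻ t) (coprime-+*⁺ t)) (coprime? (t * n + y) n) (coprime? y n)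

coprimeᵇ-prime : ∀ x {p} → Prime p → coprimeᵇ x p ≡ not (p ∣ᵇ x)
coprimeᵇ-prime x {p} pp = does-⇔ (mk⇔ (coprime-prime⁻ pp) (coprime-prime⁺ pp)) (coprime? x p) (¬? (p ∣? x))

coprimeᵇ-1 : ∀ x → coprimeᵇ x 1 ≡ true
coprimeᵇ-1 x = dec-true (coprime? x 1) (λ (_ , d∣1) → ∣1⇒≡1 d∣1)

-- With x M ≡ 1 (mod p) the solution is t = (p − 1) x b; with x M ≡ −1 it is t = x b.
linear-congruence-solvable : ∀ {p M} → Prime p → ¬ p ∣ M → ∀ b → ∃[ t ] (p ∣ t * M + b)
linear-congruence-solvable {zero} pp with prime≥2 pp
... | ()
linear-congruence-solvable {suc q} {M} pp p∤M b with coprime-Bézout (coprime-prime⁺ pp p∤M)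
... | GCD.Bézout.-+ x y 1+xM≡yp = x * b , divides (b * y) (begin
  x * b * M + b       ≡⟨ identity x b M ⟩
  b * (1 + x * M)     ≡⟨ cong (b *_) 1+xM≡yp ⟩
  b * (y * suc q)     ≡⟨ *-assoc b y (suc q) ⟨
  b * y * suc q       ∎)
  where
  open ≡-Reasoning
  identity : ∀ x b M → x * b * M + b ≡ b * (1 + x * M)
  identity = solve-∀
... | GCD.Bézout.+- x y 1+yp≡xM = x * b * q , divides (b + b * q * y) (begin
  x * b * q * M + b               ≡⟨ identity₁ x b q M ⟩
  b * q * (x * M) + b             ≡⟨ cong (λ z → b * q * z + b) 1+yp≡xM ⟨
  b * q * (1 + y * (1 + q)) + b   ≡⟨ identity₂ b q y ⟩
  (b + b * q * y) * (1 + q)       ∎)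
  where
  open ≡-Reasoning
  identity₁ : ∀ x b q M → x * b * q * M + b ≡ b * q * (x * M) + b
  identity₁ = solve-∀
  identity₂ : ∀ b q y → b * q * (1 + y * (1 + q)) + b ≡ (b + b * q * y) * (1 + q)
  identity₂ = solve-∀

linear-congruence-root : ∀ {p M} → Prime p → ¬ p ∣ M → ∀ b → ∃[ w ] (w < p × p ∣ w * M + b)
linear-congruence-root {p} {M} pp p∤M b with linear-congruence-solvable pp p∤M b
... | t , p∣tM+b = t % p , m%n<n t p , ∣m+n∣m⇒∣n (subst (p ∣_) split p∣tM+b) (∣n⇒∣m*n (t / p * M) ∣-refl)
  where
  instance _ = nonTrivial⇒nonZero p {{prime⇒nonTrivial pp}}
  split : t * M + b ≡ t / p * M * p + (t % p * M + b)
  split = trans (cong (λ s → s * M + b) (m≡m%n+[m/n]*n t p)) (identity (t % p) (t / p) p M b)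
    where
    identity : ∀ r s p M b → (r + s * p) * M + b ≡ s * M * p + (r * M + b)
    identity = solve-∀

linear-congruence-root-unique-≤ : ∀ {p M b s t} → Prime p → ¬ p ∣ M → t < p → s ≤ t →
  p ∣ s * M + b → p ∣ t * M + b → s ≡ t
linear-congruence-root-unique-≤ {p} {M} {b} {s} {t} pp p∤M t<p s≤t p∣sM+b p∣tM+b
  with euclidsLemma (t ∸ s) M pp p∣[t∸s]M
  where
  identity : ∀ s d M b → (s + d) * M + b ≡ (s * M + b) + d * M
  identity = solve-∀
  split : t * M + b ≡ (s * M + b) + (t ∸ s) * M
  split = trans (cong (λ r → r * M + b) (sym (m+[n∸m]≡n s≤t))) (identity s (t ∸ s) M b)
  p∣[t∸s]M : p ∣ (t ∸ s) * M
  p∣[t∸s]M = ∣m+n∣m⇒∣n (subst (p ∣_) split p∣tM+b) p∣sM+b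
... | inj₁ p∣t∸s = ≤-antisym s≤t (m∸n≡0⇒m≤n (∣∧<⇒≡0 p∣t∸s (≤-<-trans (m∸n≤m t s) t<p)))
... | inj₂ p∣M   = ⊥-elim (p∤M p∣M)

linear-congruence-root-unique : ∀ {p M b s t} → Prime p → ¬ p ∣ M → s < p → t < p →
  p ∣ s * M + b → p ∣ t * M + b → s ≡ t
linear-congruence-root-unique {s = s} {t} pp p∤M s<p t<p p∣sM+b p∣tM+b with ≤-total s t
... | inj₁ s≤t = linear-congruence-root-unique-≤ pp p∤M t<p s≤t p∣sM+b p∣tM+b
... | inj₂ t≤s = sym (linear-congruence-root-unique-≤ pp p∤M s<p t≤s p∣tM+b p∣sM+b)

count-linear-congruence-roots : ∀ {p M} → Prime p → ¬ p ∣ M → ∀ b →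
  countᵇ (λ t → p ∣ᵇ (t * M + b)) (range 0 p) ≡ 1
count-linear-congruence-roots {p} {M} pp p∤M b with linear-congruence-root pp p∤M b
... | w , w<p , p∣wM+b = countᵇ-range-unique (λ t → p ∣ᵇ (t * M + b)) 0 p (∈-range⁺ 0 p z≤n w<p)
  (dec-true (p ∣? _) p∣wM+b) λ t∈ ft → unique (proj₂ (∈-range⁻ 0 p t∈)) (does-true⇒ (p ∣? _) ft)
  where
  unique : ∀ {t} → t < p → p ∣ t * M + b → t ≡ w
  unique t<p p∣tM+b = linear-congruence-root-unique pp p∤M t<p w<p p∣tM+b p∣wM+b

-- The Chinese remainder count

-- The number of residues t modulo the prime p with p ∤ t (t + g).
admissible : ℕ → ℕ → ℕ
admissible g p = if p ∣ᵇ g then p ∸ 1 else p ∸ 2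

count-admissible : ∀ {p M} → Prime p → ¬ p ∣ M → ∀ a g →
  countᵇ (λ t → not (p ∣ᵇ (t * M + a)) ∧ not (p ∣ᵇ (t * M + (a + g)))) (range 0 p) ≡ admissible g p
count-admissible {p} {M} pp p∤M a g with p ∣? g
... | yes p∣g = m+n≡o⇒m≡o∸n (begin
  # (λ t → not (A t) ∧ not (B t)) + 1   ≡⟨ cong₂ _+_ (countᵇ-cong (range 0 p) (λ {t} _ → neither≡¬A t))
                                                   (sym (count-linear-congruence-roots pp p∤M a)) ⟩
  # (not ∘ A) + # A                     ≡⟨ countᵇ-not+countᵇ A (range 0 p) ⟩
  length (range 0 p)                    ≡⟨ length-range 0 p ⟩
  p                                     ∎)
  where
  open ≡-Reasoning
  # : (ℕ → Bool) → ℕ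
  # f = countᵇ f (range 0 p)
  A B : ℕ → Bool
  A t = p ∣ᵇ (t * M + a)
  B t = p ∣ᵇ (t * M + (a + g))
  A≡B : ∀ t → A t ≡ B t
  A≡B t = does-⇔ (mk⇔ (λ p∣A → subst (p ∣_) (+-assoc (t * M) a g) (∣m∣n⇒∣m+n p∣A p∣g))
                      (λ p∣B → ∣m+n∣n⇒∣m (subst (p ∣_) (sym (+-assoc (t * M) a g)) p∣B) p∣g))
                 (p ∣? (t * M + a)) (p ∣? (t * M + (a + g)))
  neither≡¬A : ∀ t → not (A t) ∧ not (B t) ≡ not (A t)
  neither≡¬A t = trans (cong (λ b → not (A t) ∧ not b) (sym (A≡B t))) (∧-idem (not (A t)))
... | no p∤g = m+n≡o⇒m≡o∸n (begin
  # (λ t → not (A t) ∧ not (B t)) + 2               ≡⟨ cong (# (λ t → not (A t) ∧ not (B t)) +_)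
                                                            (sym (cong₂ _+_ (count-linear-congruence-roots pp p∤M a)
                                                                            (count-linear-congruence-roots pp p∤M (a + g)))) ⟩
  # (λ t → not (A t) ∧ not (B t)) + (# A + # B)     ≡⟨ +-assoc (# (λ t → not (A t) ∧ not (B t))) (# A) (# B) ⟨
  # (λ t → not (A t) ∧ not (B t)) + # A + # B       ≡⟨ countᵇ-neither+countᵇ+countᵇ A B (range 0 p) disjoint ⟩
  length (range 0 p)                                ≡⟨ length-range 0 p ⟩
  p                                                 ∎)
  where
  open ≡-Reasoning
  # : (ℕ → Bool) → ℕ
  # f = countᵇ f (range 0 p)
  A B : ℕ → Bool
  A t = p ∣ᵇ (t * M + a)
  B t = p ∣ᵇ (t * M + (a + g))
  disjoint : ∀ t → A t ∧ B t ≡ false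
  disjoint t with A t in p∣A | B t in p∣B
  ... | false | _     = refl
  ... | true  | false = refl
  ... | true  | true  = ⊥-elim (p∤g (∣m+n∣m⇒∣n (subst (p ∣_) (sym (+-assoc (t * M) a g)) (does-true⇒ (p ∣? _) p∣B))
                                                (does-true⇒ (p ∣? _) p∣A)))

bothCoprime : ℕ → ℕ → ℕ → Bool
bothCoprime N g x = coprimeᵇ x N ∧ coprimeᵇ (x + g) N

pairCount : ℕ → ℕ → ℕ
pairCount N g = countᵇ (bothCoprime N g) (range 0 N)

∑-range-* : ∀ (f : ℕ → ℕ) p M → ∑ (range 0 (p * M)) f ≡ ∑ (range 0 p) (λ t → ∑ (range 0 M) (λ a → f (t * M + a)))
∑-range-* f zero    M = refl
∑-range-* f (suc p) M = begin
  ∑ (range 0 (M + p * M)) f                         ≡⟨ cong (λ k → ∑ (range 0 k) f) (+-comm M (p * M)) ⟩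
  ∑ (range 0 (p * M + M)) f                         ≡⟨ cong (λ xs → ∑ xs f) (range-++ 0 (p * M) M) ⟩
  ∑ (range 0 (p * M) ++ range (p * M) M) f          ≡⟨ ∑-++ (range 0 (p * M)) (range (p * M) M) f ⟩
  ∑ (range 0 (p * M)) f + ∑ (range (p * M) M) f     ≡⟨ cong₂ _+_ (∑-range-* f p M) lastBlock ⟩
  ∑ (range 0 p) block + (block p + 0)               ≡⟨ ∑-++ (range 0 p) (p ∷ []) block ⟨
  ∑ (range 0 p ∷ʳ p) block                          ≡⟨ cong (λ xs → ∑ xs block) (range-∷ʳ 0 p) ⟨
  ∑ (range 0 (suc p)) block                         ∎
  where
  open ≡-Reasoning
  block : ℕ → ℕ
  block t = ∑ (range 0 M) (λ a → f (t * M + a))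
  lastBlock : ∑ (range (p * M) M) f ≡ block p + 0
  lastBlock = begin
    ∑ (range (p * M) M) f               ≡⟨ cong (λ c → ∑ (range c M) f) (+-identityʳ (p * M)) ⟨
    ∑ (range (p * M + 0) M) f           ≡⟨ cong (λ xs → ∑ xs f) (map-+-range (p * M) 0 M) ⟨
    ∑ (map (p * M +_) (range 0 M)) f    ≡⟨ ∑-map (p * M +_) (range 0 M) f ⟩
    block p                             ≡⟨ +-identityʳ (block p) ⟨
    block p + 0                         ∎

coprimeᵇ-prime* : ∀ {p} → Prime p → ∀ t M b →
  coprimeᵇ (t * M + b) (p * M) ≡ coprimeᵇ b M ∧ not (p ∣ᵇ (t * M + b))
coprimeᵇ-prime* {p} pp t M b = begin
  coprimeᵇ (t * M + b) (p * M)                           ≡⟨ coprimeᵇ-* (t * M + b) p M ⟩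
  coprimeᵇ (t * M + b) p ∧ coprimeᵇ (t * M + b) M        ≡⟨ cong₂ _∧_ (coprimeᵇ-prime (t * M + b) pp) (coprimeᵇ-+* t M b) ⟩
  not (p ∣ᵇ (t * M + b)) ∧ coprimeᵇ b M                  ≡⟨ ∧-comm (not (p ∣ᵇ (t * M + b))) (coprimeᵇ b M) ⟩
  coprimeᵇ b M ∧ not (p ∣ᵇ (t * M + b))                  ∎
  where open ≡-Reasoning

-- Writing x = t M + a with t < p and a < M, the condition on x splits into the
-- same condition on a modulo M and the condition p ∤ x (x + g) on t.
pairCount-prime* : ∀ {p M} → Prime p → ¬ p ∣ M → ∀ g → pairCount (p * M) g ≡ admissible g p * pairCount M g
pairCount-prime* {p} {M} pp p∤M g = begin
  ∑ (range 0 (p * M)) (boolToℕ ∘ both (p * M))                                 ≡⟨ ∑-range-* (boolToℕ ∘ both (p * M)) p M ⟩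
  ∑ (range 0 p) (λ t → ∑ (range 0 M) (λ a → boolToℕ (both (p * M) (t * M + a))))
    ≡⟨ ∑-comm (range 0 p) (range 0 M) (λ t a → boolToℕ (both (p * M) (t * M + a))) ⟩
  ∑ (range 0 M) (λ a → ∑ (range 0 p) (λ t → boolToℕ (both (p * M) (t * M + a))))
    ≡⟨ ∑-cong (range 0 M) (λ {a} _ → column a) ⟩
  ∑ (range 0 M) (λ a → admissible g p * boolToℕ (both M a))                    ≡⟨ ∑-*ˡ (admissible g p) (range 0 M) (boolToℕ ∘ both M) ⟩
  admissible g p * pairCount M g                                               ∎
  where
  open ≡-Reasoning
  both : ℕ → ℕ → Bool
  both N = bothCoprime N g
  avoids : ℕ → ℕ → Bool
  avoids a t = not (p ∣ᵇ (t * M + a)) ∧ not (p ∣ᵇ (t * M + (a + g)))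
  cell : ∀ a t → both (p * M) (t * M + a) ≡ both M a ∧ avoids a t
  cell a t = begin
    coprimeᵇ (t * M + a) (p * M) ∧ coprimeᵇ (t * M + a + g) (p * M)
      ≡⟨ cong (λ x → coprimeᵇ (t * M + a) (p * M) ∧ coprimeᵇ x (p * M)) (+-assoc (t * M) a g) ⟩
    coprimeᵇ (t * M + a) (p * M) ∧ coprimeᵇ (t * M + (a + g)) (p * M)
      ≡⟨ cong₂ _∧_ (coprimeᵇ-prime* pp t M a) (coprimeᵇ-prime* pp t M (a + g)) ⟩
    (coprimeᵇ a M ∧ not (p ∣ᵇ (t * M + a))) ∧ (coprimeᵇ (a + g) M ∧ not (p ∣ᵇ (t * M + (a + g))))
      ≡⟨ ∧-interchange (coprimeᵇ a M) _ (coprimeᵇ (a + g) M) _ ⟩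
    both M a ∧ avoids a t ∎
  column : ∀ a → ∑ (range 0 p) (λ t → boolToℕ (both (p * M) (t * M + a))) ≡ admissible g p * boolToℕ (both M a)
  column a = begin
    ∑ (range 0 p) (λ t → boolToℕ (both (p * M) (t * M + a)))
      ≡⟨ ∑-cong (range 0 p) (λ {t} _ → trans (cong boolToℕ (cell a t)) (boolToℕ-∧ (both M a) (avoids a t))) ⟩
    ∑ (range 0 p) (λ t → boolToℕ (both M a) * boolToℕ (avoids a t))
      ≡⟨ ∑-*ˡ (boolToℕ (both M a)) (range 0 p) (boolToℕ ∘ avoids a) ⟩
    boolToℕ (both M a) * countᵇ (avoids a) (range 0 p)
      ≡⟨ cong (boolToℕ (both M a) *_) (count-admissible pp p∤M a g) ⟩
    boolToℕ (both M a) * admissible g p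
      ≡⟨ *-comm (boolToℕ (both M a)) (admissible g p) ⟩
    admissible g p * boolToℕ (both M a) ∎

prime∤product : ∀ {p qs} → Prime p → All Prime qs → All (p <_) qs → ¬ p ∣ product qs
prime∤product pp []         []            p∣1 = prime≢1 pp (∣1⇒≡1 p∣1)
prime∤product pp (qp ∷ qps) (p<q ∷ p<qs) p∣qQ with euclidsLemma _ _ pp p∣qQ
... | inj₂ p∣Q = prime∤product pp qps p<qs p∣Q
... | inj₁ p∣q with prime⇒irreducible qp p∣q
...   | inj₁ p≡1 = prime≢1 pp p≡1
...   | inj₂ p≡q = <-irrefl p≡q p<q

pairCount-product : ∀ {ps} → All Prime ps → AllPairs _<_ ps → ∀ g → pairCount (product ps) g ≡ product (map (admissible g) ps)
pairCount-product []         []             g = cong (λ b → boolToℕ (coprimeᵇ 0 1 ∧ b) + 0) (coprimeᵇ-1 g)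
pairCount-product {p ∷ _} (pp ∷ pps) (p<ps ∷ <ps) g =
  trans (pairCount-prime* pp (prime∤product pp pps p<ps) g) (cong (admissible g p *_) (pairCount-product pps <ps g))

-- Driving terms

bothCoprime-periodic : ∀ N g → bothCoprime N g N ≡ bothCoprime N g 0
bothCoprime-periodic N g = cong₂ _∧_ (trans (cong (λ x → coprimeᵇ x N) (sym (+-identityʳ N))) (shift 0)) (shift g)
  where
  shift : ∀ y → coprimeᵇ (N + y) N ≡ coprimeᵇ y N
  shift y = trans (cong (λ z → coprimeᵇ (z + y) N) (sym (*-identityˡ N))) (coprimeᵇ-+* 1 N y)

pairCount-from-1 : ∀ N-1 g → countᵇ (bothCoprime (suc N-1) g) (range 1 (suc N-1)) ≡ pairCount (suc N-1) g
pairCount-from-1 N-1 g = begin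
  countᵇ P (range 1 N)                         ≡⟨ cong (countᵇ P) (range-∷ʳ 1 N-1) ⟩
  countᵇ P (range 1 N-1 ∷ʳ N)                  ≡⟨ ∑-++ (range 1 N-1) (N ∷ []) (boolToℕ ∘ P) ⟩
  countᵇ P (range 1 N-1) + (boolToℕ (P N) + 0) ≡⟨ cong (λ b → countᵇ P (range 1 N-1) + (boolToℕ b + 0)) (bothCoprime-periodic N g) ⟩
  countᵇ P (range 1 N-1) + (boolToℕ (P 0) + 0) ≡⟨ cong (countᵇ P (range 1 N-1) +_) (+-identityʳ (boolToℕ (P 0))) ⟩
  countᵇ P (range 1 N-1) + boolToℕ (P 0)       ≡⟨ +-comm (countᵇ P (range 1 N-1)) (boolToℕ (P 0)) ⟩
  pairCount N g                                ∎
  where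
  open ≡-Reasoning
  N = suc N-1
  P = bothCoprime N g

φ≡pairCount : ∀ {N} → 1 ≤ N → φ N ≡ pairCount N 0
φ≡pairCount {suc N-1} _ = begin
  length (filter (λ k → coprime? k N) (interval 1 N))   ≡⟨ length-filter≡countᵇ (λ k → coprime? k N) (interval 1 N) ⟩
  countᵇ (λ k → coprimeᵇ k N) (interval 1 N)            ≡⟨ cong (countᵇ (λ k → coprimeᵇ k N)) (interval≡range 1 N) ⟩
  countᵇ (λ k → coprimeᵇ k N) (range 1 N)               ≡⟨ countᵇ-cong (range 1 N) (λ {k} _ → self-pair k) ⟩
  countᵇ (bothCoprime N 0) (range 1 N)                  ≡⟨ pairCount-from-1 N-1 0 ⟩
  pairCount N 0                                         ∎
  where
  open ≡-Reasoning
  N = suc N-1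
  self-pair : ∀ k → coprimeᵇ k N ≡ bothCoprime N 0 k
  self-pair k = trans (sym (∧-idem (coprimeᵇ k N))) (cong (λ x → coprimeᵇ k N ∧ coprimeᵇ x N) (sym (+-identityʳ k)))

module UnitSequence (N-1 : ℕ) where

  N : ℕ
  N = suc N-1

  coprime-to-N? : ∀ k → Dec (Coprime k N)
  coprime-to-N? k = coprime? k N

  U : List ℕ
  U = filter coprime-to-N? (range 1 N)

  U⁺ : List ℕ
  U⁺ = U ∷ʳ suc N

  m-1 : ℕ
  m-1 = length (filter coprime-to-N? (range 2 N-1))

  m : ℕ
  m = suc m-1

  U≡1∷ : U ≡ 1 ∷ filter coprime-to-N? (range 2 N-1)
  U≡1∷ = filter-accept coprime-to-N? (1-coprimeTo N)

  length-U : length U ≡ m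
  length-U = cong length U≡1∷

  nth-U-0 : nth U 0 ≡ 1
  nth-U-0 = cong (λ xs → nth xs 0) U≡1∷

  units≡U⁺ : units N ≡ U⁺
  units≡U⁺ = begin
    filter coprime-to-N? (interval 1 (suc N))                  ≡⟨ cong (filter coprime-to-N?) (interval≡range 1 (suc N)) ⟩
    filter coprime-to-N? (range 1 (suc N))                     ≡⟨ cong (filter coprime-to-N?) (range-∷ʳ 1 N) ⟩
    filter coprime-to-N? (range 1 N ∷ʳ suc N)                  ≡⟨ filter-++ coprime-to-N? (range 1 N) (suc N ∷ []) ⟩
    U ++ filter coprime-to-N? (suc N ∷ [])                     ≡⟨ cong (U ++_) (filter-accept coprime-to-N? N+1-coprime) ⟩
    U⁺                                                         ∎
    where
    open ≡-Reasoning
    N+1-coprime : Coprime (suc N) N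
    N+1-coprime = subst (λ x → Coprime x N) (trans (cong (_+ 1) (*-identityˡ N)) (+-comm N 1)) (coprime-+*⁺ 1 (1-coprimeTo N))

  length-gapList : length (gapList N) ≡ m
  length-gapList = begin
    length (gapList N)                                         ≡⟨ cong (length ∘ diffs) units≡U⁺ ⟩
    length (diffs U⁺)                                          ≡⟨ cong (λ xs → length (diffs (xs ∷ʳ suc N))) U≡1∷ ⟩
    length (diffs (1 ∷ (filter coprime-to-N? (range 2 N-1) ∷ʳ suc N)))
                                                               ≡⟨ length-diffs 1 (filter coprime-to-N? (range 2 N-1) ∷ʳ suc N) ⟩
    length (filter coprime-to-N? (range 2 N-1) ∷ʳ suc N)       ≡⟨ length-++ (filter coprime-to-N? (range 2 N-1)) ⟩
    m-1 + 1                                                    ≡⟨ +-comm m-1 1 ⟩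
    m                                                          ∎
    where open ≡-Reasoning

  U⁺-increasing : AllPairs _<_ U⁺
  U⁺-increasing = AllPairs.++⁺ (AllPairs.filter⁺ coprime-to-N? (range-increasing 1 N)) ([] ∷ [])
    (All.tabulate (λ x∈U → (proj₂ (∈-range⁻ 1 N (proj₁ (∈-filter⁻ coprime-to-N? x∈U)))) ∷ []))

  nth-U⁺ : ∀ {r} → r < m → nth U⁺ r ≡ nth U r
  nth-U⁺ r<m = nth-++ˡ U (suc N ∷ []) (subst (_ <_) (sym length-U) r<m)

  nth-U⁺-m : nth U⁺ m ≡ suc N
  nth-U⁺-m = subst (λ i → nth U⁺ i ≡ suc N) length-U (nth-length-∷ʳ U (suc N))

  length-U⁺ : length U⁺ ≡ suc m
  length-U⁺ = trans (length-++ U) (trans (cong (_+ 1) length-U) (+-comm m 1))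

  U⁺-step : ∀ {r} → r < m → nth U⁺ r < nth U⁺ (suc r)
  U⁺-step r<m = nth-increasing U⁺-increasing (subst (_ <_) (sym length-U⁺) (s≤s r<m))

  r+qm%m≡r : ∀ {r} q → r < m → (r + q * m) % m ≡ r
  r+qm%m≡r {r} q r<m = trans ([m+kn]%n≡m%n r q m) (m<n⇒m%n≡m r<m)

  gap-at : ∀ {k r} q → r < m → k ≡ r + q * m → gap N (suc k) ≡ nth U⁺ (suc r) ∸ nth U⁺ r
  gap-at {k} {r} q r<m refl = begin
    nth (gapList N) (modL k (length (gapList N)))   ≡⟨ cong (λ l → nth (gapList N) (modL k l)) length-gapList ⟩
    nth (gapList N) (k % m)                         ≡⟨ cong₂ nth (cong diffs units≡U⁺) (r+qm%m≡r q r<m) ⟩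
    nth (diffs U⁺) r                                ≡⟨ nth-diffs U⁺ (subst (_ <_) (sym length-U⁺) (s≤s r<m)) ⟩
    nth U⁺ (suc r) ∸ nth U⁺ r                       ∎
    where open ≡-Reasoning

  -- Defined through the gaps so that window sums telescope; u-periodic identifies it with
  -- the periodic continuation u (r + q m) = U r + q N of the units.
  u : ℕ → ℕ
  u zero    = 1
  u (suc k) = u k + gap N (suc k)

  Decomposition : ℕ → Set
  Decomposition k = ∃[ r ] ∃[ q ] (r < m × k ≡ r + q * m × u k ≡ nth U r + q * N)

  u-step : ∀ {k r} q → r < m → k ≡ r + q * m → u k ≡ nth U r + q * N → u (suc k) ≡ nth U⁺ (suc r) + q * N
  u-step {k} {r} q r<m k≡ uk≡ = begin
    u k + gap N (suc k)                               ≡⟨ cong₂ _+_ (trans uk≡ (cong (_+ q * N) (sym (nth-U⁺ r<m)))) (gap-at q r<m k≡) ⟩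
    nth U⁺ r + q * N + (nth U⁺ (suc r) ∸ nth U⁺ r)    ≡⟨ a+c+[b∸a]≡b+c (<⇒≤ (U⁺-step r<m)) ⟩
    nth U⁺ (suc r) + q * N                            ∎
    where
    open ≡-Reasoning
    a+c+[b∸a]≡b+c : ∀ {a b c} → a ≤ b → a + c + (b ∸ a) ≡ b + c
    a+c+[b∸a]≡b+c {a} {b} {c} a≤b = begin
      a + c + (b ∸ a)   ≡⟨ +-assoc a c (b ∸ a) ⟩
      a + (c + (b ∸ a)) ≡⟨ cong (a +_) (+-comm c (b ∸ a)) ⟩
      a + (b ∸ a + c)   ≡⟨ +-assoc a (b ∸ a) c ⟨
      a + (b ∸ a) + c   ≡⟨ cong (_+ c) (m+[n∸m]≡n a≤b) ⟩
      b + c             ∎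

  u-decomposition : ∀ k → Decomposition k
  u-decomposition zero = 0 , 0 , s≤s z≤n , refl , cong (_+ 0) (sym nth-U-0)
  u-decomposition (suc k) with u-decomposition k
  ... | r , q , r<m , k≡ , uk≡ with m≤n⇒m<n∨m≡n r<m
  ...   | inj₁ r+1<m = suc r , q , r+1<m , cong suc k≡ , trans (u-step q r<m k≡ uk≡) (cong (_+ q * N) (nth-U⁺ r+1<m))
  ...   | inj₂ r+1≡m = 0 , suc q , s≤s z≤n , trans (cong suc k≡) (cong (_+ q * m) r+1≡m) , (begin
    u (suc k)                 ≡⟨ u-step q r<m k≡ uk≡ ⟩
    nth U⁺ (suc r) + q * N    ≡⟨ cong (λ i → nth U⁺ i + q * N) r+1≡m ⟩
    nth U⁺ m + q * N          ≡⟨ cong (_+ q * N) nth-U⁺-m ⟩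
    1 + suc q * N             ≡⟨ cong (_+ suc q * N) nth-U-0 ⟨
    nth U 0 + suc q * N       ∎)
    where open ≡-Reasoning

  gap-positive : ∀ k → 0 < gap N (suc k)
  gap-positive k with u-decomposition k
  ... | r , q , r<m , k≡ , _ = subst (0 <_) (sym (gap-at q r<m k≡)) (m<n⇒0<n∸m (U⁺-step r<m))

  u-coprime : ∀ k → Coprime (u k) N
  u-coprime k with u-decomposition k
  ... | r , q , r<m , _ , uk≡ = subst (λ x → Coprime x N) (trans (+-comm (q * N) (nth U r)) (sym uk≡))
    (coprime-+*⁺ q (proj₂ (∈-filter⁻ coprime-to-N? {xs = range 1 N} (nth-∈ U (subst (_ <_) (sym length-U) r<m)))))

  u-+-≤ : ∀ k j → u k + j ≤ u (k + j)
  u-+-≤ k zero    = ≤-reflexive (trans (+-identityʳ (u k)) (cong u (sym (+-identityʳ k))))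
  u-+-≤ k (suc j) = subst₂ _≤_ (sym (+-suc (u k) j)) (cong u (sym (+-suc k j)))
                           (<-≤-trans (s≤s (u-+-≤ k j)) (m<m+n (u (k + j)) (gap-positive (k + j))))

  u-mono-≤ : ∀ {k l} → k ≤ l → u k ≤ u l
  u-mono-≤ {k} {l} k≤l = ≤-trans (m≤m+n (u k) (l ∸ k))
    (subst (λ i → u k + (l ∸ k) ≤ u i) (m+[n∸m]≡n k≤l) (u-+-≤ k (l ∸ k)))

  u-mono-< : ∀ {k l} → k < l → u k < u l
  u-mono-< {k} {l} k<l = <-≤-trans (m<m+n (u k) (m<n⇒0<n∸m k<l))
    (subst (λ i → u k + (l ∸ k) ≤ u i) (m+[n∸m]≡n (<⇒≤ k<l)) (u-+-≤ k (l ∸ k)))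

  u-injective : ∀ {k l} → u k ≡ u l → k ≡ l
  u-injective {k} {l} uk≡ul with <-cmp k l
  ... | tri< k<l _ _ = ⊥-elim (<-irrefl uk≡ul (u-mono-< k<l))
  ... | tri≈ _ k≡l _ = k≡l
  ... | tri> _ _ l<k = ⊥-elim (<-irrefl (sym uk≡ul) (u-mono-< l<k))

  u-periodic : ∀ {r} q → r < m → u (r + q * m) ≡ nth U r + q * N
  u-periodic {r} q r<m with u-decomposition (r + q * m)
  ... | r′ , q′ , r′<m , k≡ , uk≡ with remainder-unique k≡
    where
    remainder-unique : r + q * m ≡ r′ + q′ * m → r′ ≡ r × q′ ≡ q
    remainder-unique e = r′≡r , *-cancelʳ-≡ q′ q m (+-cancelˡ-≡ r _ _ (trans (cong (_+ q′ * m) (sym r′≡r)) (sym e)))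
      where
      r′≡r : r′ ≡ r
      r′≡r = trans (sym (r+qm%m≡r q′ r′<m)) (trans (cong (_% m) (sym e)) (r+qm%m≡r q r<m))
  ... | refl , refl = uk≡

  u-below-m : ∀ {k} → k < m → u k ≡ nth U k
  u-below-m {k} k<m = trans (cong u (sym (+-identityʳ k))) (trans (u-periodic 0 k<m) (+-identityʳ (nth U k)))

  u-hits-translates : ∀ {y} q → y ∈ U → ∃[ k ] (u k ≡ y + q * N)
  u-hits-translates q y∈U with ∈⇒nth U y∈U
  ... | r , r<|U| , Uᵣ≡y = r + q * m , trans (u-periodic q (subst (r <_) length-U r<|U|)) (cong (_+ q * N) Uᵣ≡y)

  u-surjective : ∀ x → 1 ≤ x → Coprime x N → ∃[ k ] (u k ≡ x)
  u-surjective (suc x) _ coprime = subst (λ z → ∃[ k ] (u k ≡ z)) (sym x+1≡y+qN) (u-hits-translates q y∈U)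
    where
    q = x / N
    y = suc (x % N)
    x+1≡y+qN : suc x ≡ y + q * N
    x+1≡y+qN = cong suc (m≡m%n+[m/n]*n x N)
    y∈U : y ∈ U
    y∈U = ∈-filter⁺ coprime-to-N? (∈-range⁺ 1 N (s≤s z≤n) (s≤s (m%n<n x N)))
      (coprime-+*⁻ q (subst (λ z → Coprime z N) (trans x+1≡y+qN (+-comm y (q * N))) coprime))

  u-cancel-< : ∀ {k l} → u k < u l → k < l
  u-cancel-< uk<ul = ≰⇒> (λ l≤k → <⇒≱ uk<ul (u-mono-≤ l≤k))

  windowSum+u : ∀ k j → windowSum N (suc k) j + u k ≡ u (k + j)
  windowSum+u k j = trans (cong (_+ u k) (trans (cong (λ ts → sum (map (gap N ∘ (suc k +_)) ts)) (upTo≡range j))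
                                               (sum-map≡∑ (gap N ∘ (suc k +_)) (range 0 j))))
                          (∑-window k j)
    where
    ∑-window : ∀ k j → ∑ (range 0 j) (gap N ∘ (suc k +_)) + u k ≡ u (k + j)
    ∑-window k zero    = cong u (sym (+-identityʳ k))
    ∑-window k (suc j) = begin
      ∑ (range 0 (suc j)) F + u k           ≡⟨ cong (λ ts → ∑ ts F + u k) (range-∷ʳ 0 j) ⟩
      ∑ (range 0 j ∷ʳ j) F + u k            ≡⟨ cong (_+ u k) (∑-++ (range 0 j) (j ∷ []) F) ⟩
      ∑ (range 0 j) F + (F j + 0) + u k     ≡⟨ rearrange (∑ (range 0 j) F) (F j) (u k) ⟩
      ∑ (range 0 j) F + u k + F j           ≡⟨ cong (_+ F j) (∑-window k j) ⟩
      u (k + j) + gap N (suc (k + j))       ≡⟨ cong u (+-suc k j) ⟨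
      u (k + suc j)                         ∎
      where
      open ≡-Reasoning
      F = gap N ∘ (suc k +_)
      rearrange : ∀ x y z → x + (y + 0) + z ≡ x + z + y
      rearrange = solve-∀

  window≡g⇔ : ∀ k j g → windowSum N (suc k) j ≡ g ⇔ u (k + j) ≡ u k + g
  window≡g⇔ k j g = mk⇔
    (λ w≡g → trans (sym (windowSum+u k j)) (trans (cong (_+ u k) w≡g) (+-comm g (u k))))
    (λ u≡ → +-cancelʳ-≡ (u k) _ _ (trans (windowSum+u k j) (trans u≡ (+-comm (u k) g))))

  drivingWindows-from : ∀ {g J} → 1 ≤ g → g ≤ J → ∀ k →
    countᵇ (λ j → does (windowSum N (suc k) j ≟ g)) (range 1 J) ≡ boolToℕ (coprimeᵇ (u k + g) N)
  drivingWindows-from {g} {J} g≥1 g≤J k with coprime? (u k + g) N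
  ... | no ¬coprime = trans (countᵇ-none (range 1 J) λ {j} _ → dec-false (windowSum N (suc k) j ≟ g) (¬window j))
                            (cong boolToℕ (sym (dec-false (coprime? (u k + g) N) ¬coprime)))
    where
    ¬window : ∀ j → windowSum N (suc k) j ≢ g
    ¬window j w≡g = ¬coprime (subst (λ x → Coprime x N) (Equivalence.to (window≡g⇔ k j g) w≡g) (u-coprime (k + j)))
  ... | yes coprime with u-surjective (u k + g) (≤-trans g≥1 (m≤n+m g (u k))) coprime
  ...   | K , uK≡ = trans (countᵇ-range-unique isDriving 1 J (∈-range⁺ 1 J 1≤j₀ (s≤s j₀≤J)) j₀-driving unique)
                          (cong boolToℕ (sym (dec-true (coprime? (u k + g) N) coprime)))
    where
    isDriving : ℕ → Bool
    isDriving j = does (windowSum N (suc k) j ≟ g)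
    k<K : k < K
    k<K = u-cancel-< (subst (u k <_) (sym uK≡) (m<m+n (u k) g≥1))
    j₀ = K ∸ k
    k+j₀≡K : k + j₀ ≡ K
    k+j₀≡K = m+[n∸m]≡n (<⇒≤ k<K)
    1≤j₀ : 1 ≤ j₀
    1≤j₀ = m<n⇒0<n∸m k<K
    j₀≤J : j₀ ≤ J
    j₀≤J = ≤-trans (+-cancelˡ-≤ (u k) j₀ g (subst (u k + j₀ ≤_) (trans (cong u k+j₀≡K) uK≡) (u-+-≤ k j₀))) g≤J
    j₀-driving : isDriving j₀ ≡ true
    j₀-driving = dec-true (windowSum N (suc k) j₀ ≟ g) (Equivalence.from (window≡g⇔ k j₀ g) (trans (cong u k+j₀≡K) uK≡))
    unique : ∀ {j} → j ∈ range 1 J → isDriving j ≡ true → j ≡ j₀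
    unique {j} _ j-driving = +-cancelˡ-≡ k j j₀ (u-injective (begin
      u (k + j)   ≡⟨ Equivalence.to (window≡g⇔ k j g) (does-true⇒ (windowSum N (suc k) j ≟ g) j-driving) ⟩
      u k + g     ≡⟨ uK≡ ⟨
      u K         ≡⟨ cong u k+j₀≡K ⟨
      u (k + j₀)  ∎))
      where open ≡-Reasoning

  drivingCount≡countᵇ : ∀ g j → drivingCount g j N ≡ countᵇ (λ i → does (windowSum N i j ≟ g)) (range 1 m)
  drivingCount≡countᵇ g j = begin
    length (filter (λ i → windowSum N i j ≟ g) (interval 1 (length (gapList N))))
      ≡⟨ length-filter≡countᵇ (λ i → windowSum N i j ≟ g) (interval 1 (length (gapList N))) ⟩
    countᵇ (λ i → does (windowSum N i j ≟ g)) (interval 1 (length (gapList N)))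
      ≡⟨ cong (countᵇ (λ i → does (windowSum N i j ≟ g))) (interval≡range 1 (length (gapList N))) ⟩
    countᵇ (λ i → does (windowSum N i j ≟ g)) (range 1 (length (gapList N)))
      ≡⟨ cong (λ l → countᵇ (λ i → does (windowSum N i j ≟ g)) (range 1 l)) length-gapList ⟩
    countᵇ (λ i → does (windowSum N i j ≟ g)) (range 1 m) ∎
    where open ≡-Reasoning

  partialDrivingSum≡∑-starts : ∀ g J →
    partialDrivingSum g N J ≡ ∑ (range 0 m) (λ k → countᵇ (λ j → does (windowSum N (suc k) j ≟ g)) (range 1 J))
  partialDrivingSum≡∑-starts g J = begin
    sum (map (λ j → drivingCount g j N) (interval 1 J))
      ≡⟨ sum-map≡∑ (λ j → drivingCount g j N) (interval 1 J) ⟩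
    ∑ (interval 1 J) (λ j → drivingCount g j N)
      ≡⟨ cong (λ js → ∑ js (λ j → drivingCount g j N)) (interval≡range 1 J) ⟩
    ∑ (range 1 J) (λ j → drivingCount g j N)
      ≡⟨ ∑-cong (range 1 J) (λ {j} _ → drivingCount≡countᵇ g j) ⟩
    ∑ (range 1 J) (λ j → countᵇ (λ i → isDriving i j) (range 1 m))
      ≡⟨ ∑-comm (range 1 J) (range 1 m) (λ j i → boolToℕ (isDriving i j)) ⟩
    ∑ (range 1 m) (λ i → countᵇ (isDriving i) (range 1 J))
      ≡⟨ cong (λ is → ∑ is (λ i → countᵇ (isDriving i) (range 1 J))) (map-suc-range 0 m) ⟨
    ∑ (map suc (range 0 m)) (λ i → countᵇ (isDriving i) (range 1 J))
      ≡⟨ ∑-map suc (range 0 m) (λ i → countᵇ (isDriving i) (range 1 J)) ⟩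
    ∑ (range 0 m) (λ k → countᵇ (isDriving (suc k)) (range 1 J)) ∎
    where
    open ≡-Reasoning
    isDriving : ℕ → ℕ → Bool
    isDriving i j = does (windowSum N i j ≟ g)

  ∑-starts≡pairCount : ∀ g → ∑ (range 0 m) (λ k → boolToℕ (coprimeᵇ (u k + g) N)) ≡ pairCount N g
  ∑-starts≡pairCount g = begin
    ∑ (range 0 m) (λ k → boolToℕ (coprimeᵇ (u k + g) N))
      ≡⟨ ∑-cong (range 0 m) (λ {k} k∈ → cong (λ x → boolToℕ (coprimeᵇ (x + g) N)) (u-below-m (proj₂ (∈-range⁻ 0 m k∈)))) ⟩
    ∑ (range 0 m) (λ k → boolToℕ (coprimeᵇ (nth U k + g) N))
      ≡⟨ cong (λ l → ∑ (range 0 l) (λ k → boolToℕ (coprimeᵇ (nth U k + g) N))) length-U ⟨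
    ∑ (range 0 (length U)) (λ k → boolToℕ (coprimeᵇ (nth U k + g) N))
      ≡⟨ ∑-map (nth U) (range 0 (length U)) (λ x → boolToℕ (coprimeᵇ (x + g) N)) ⟨
    countᵇ (λ x → coprimeᵇ (x + g) N) (map (nth U) (range 0 (length U)))
      ≡⟨ cong (countᵇ (λ x → coprimeᵇ (x + g) N)) (map-nth-range U) ⟩
    countᵇ (λ x → coprimeᵇ (x + g) N) U
      ≡⟨ countᵇ-filter coprime-to-N? (λ x → coprimeᵇ (x + g) N) (range 1 N) ⟩
    countᵇ (bothCoprime N g) (range 1 N)
      ≡⟨ pairCount-from-1 N-1 g ⟩
    pairCount N g ∎
    where open ≡-Reasoning

  partialDrivingSum≡pairCount : ∀ {g J} → 1 ≤ g → g ≤ J → partialDrivingSum g N J ≡ pairCount N g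
  partialDrivingSum≡pairCount {g} {J} g≥1 g≤J = begin
    partialDrivingSum g N J                                                         ≡⟨ partialDrivingSum≡∑-starts g J ⟩
    ∑ (range 0 m) (λ k → countᵇ (λ j → does (windowSum N (suc k) j ≟ g)) (range 1 J)) ≡⟨ ∑-cong (range 0 m) (λ {k} _ → drivingWindows-from g≥1 g≤J k) ⟩
    ∑ (range 0 m) (λ k → boolToℕ (coprimeᵇ (u k + g) N))                            ≡⟨ ∑-starts≡pairCount g ⟩
    pairCount N g                                                                   ∎
    where open ≡-Reasoning

partialDrivingSum-stable : ∀ {N g J} → 1 ≤ N → 1 ≤ g → g ≤ J → partialDrivingSum g N J ≡ pairCount N g
partialDrivingSum-stable {suc N-1} _ = UnitSequence.partialDrivingSum≡pairCount N-1

-- Primorials and radicals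

filter-filter : ∀ {P Q : ℕ → Set} (P? : ∀ x → Dec (P x)) (Q? : ∀ x → Dec (Q x)) xs →
  filter Q? (filter P? xs) ≡ filter (λ x → P? x ×-dec Q? x) xs
filter-filter P? Q? []       = refl
filter-filter P? Q? (x ∷ xs) with does (P? x)
... | false = filter-filter P? Q? xs
... | true with does (Q? x)
...   | true  = cong (x ∷_) (filter-filter P? Q? xs)
...   | false = filter-filter P? Q? xs

product-map-partition : ∀ {P : ℕ → Set} (P? : ∀ x → Dec (P x)) (f : ℕ → ℕ) xs →
  product (map f xs) ≡ product (map f (filter P? xs)) * product (map f (filter (¬? ∘ P?) xs))
product-map-partition P? f []       = refl
product-map-partition P? f (x ∷ xs) with does (P? x)
... | true  = trans (cong (f x *_) (product-map-partition P? f xs)) (sym (*-assoc (f x) _ _))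
... | false = trans (cong (f x *_) (product-map-partition P? f xs))
                    (x*[y*z]≡y*[x*z] (f x) (product (map f (filter P? xs))) (product (map f (filter (¬? ∘ P?) xs))))
  where
  x*[y*z]≡y*[x*z] : ∀ x y z → x * (y * z) ≡ y * (x * z)
  x*[y*z]≡y*[x*z] = solve-∀

product-map-pos : ∀ (f : ℕ → ℕ) xs → (∀ {x} → x ∈ xs → 1 ≤ f x) → 1 ≤ product (map f xs)
product-map-pos f []       _   = ≤-refl
product-map-pos f (x ∷ xs) pos = *-mono-≤ (pos (here refl)) (product-map-pos f xs (pos ∘ there))

prime∣product⇒∈ : ∀ {p qs} → Prime p → All Prime qs → p ∣ product qs → p ∈ qs
prime∣product⇒∈ pp []         p∣1 = ⊥-elim (prime≢1 pp (∣1⇒≡1 p∣1))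
prime∣product⇒∈ pp (qp ∷ qps) p∣qQ with euclidsLemma _ _ pp p∣qQ
... | inj₂ p∣Q = there (prime∣product⇒∈ pp qps p∣Q)
... | inj₁ p∣q with prime⇒irreducible qp p∣q
...   | inj₁ p≡1 = ⊥-elim (prime≢1 pp p≡1)
...   | inj₂ refl = here refl

interval-increasing : ∀ a b → AllPairs _<_ (interval a b)
interval-increasing a b = subst (AllPairs _<_) (sym (interval≡range a b)) (range-increasing a (suc b ∸ a))

primesUpTo-prime : ∀ n → All Prime (primesUpTo n)
primesUpTo-prime n = All.all-filter prime? (interval 1 n)

primesUpTo-increasing : ∀ n → AllPairs _<_ (primesUpTo n)
primesUpTo-increasing n = AllPairs.filter⁺ prime? (interval-increasing 1 n)

primeDivisors-prime : ∀ m → All Prime (primeDivisors m)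
primeDivisors-prime m = All.map proj₁ (All.all-filter (λ q → prime? q ×-dec q ∣? m) (interval 1 m))

primeDivisors-increasing : ∀ m → AllPairs _<_ (primeDivisors m)
primeDivisors-increasing m = AllPairs.filter⁺ (λ q → prime? q ×-dec q ∣? m) (interval-increasing 1 m)

∈-interval⁺ : ∀ {x a b} → a ≤ x → x ≤ b → x ∈ interval a b
∈-interval⁺ {x} {a} {b} a≤x x≤b = subst (x ∈_) (sym (interval≡range a b))
  (∈-range⁺ a (suc b ∸ a) a≤x (subst (x <_) (sym (m+[n∸m]≡n (≤-trans (≤-trans a≤x x≤b) (n≤1+n b)))) (s≤s x≤b)))

prime∣radical⇔prime∣ : ∀ {m p} → 1 ≤ m → Prime p → p ∣ radical m ⇔ p ∣ m
prime∣radical⇔prime∣ {m} {p} m≥1 pp = mk⇔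
  (λ p∣Q → proj₂ (proj₂ (∈-filter⁻ D {xs = interval 1 m} (prime∣product⇒∈ pp (primeDivisors-prime m) p∣Q))))
  (λ p∣m → ∈⇒∣product (∈-filter⁺ D (∈-interval⁺ (≤-trans (s≤s z≤n) (prime≥2 pp)) (∣⇒≤ {{>-nonZero m≥1}} p∣m)) (pp , p∣m)))
  where
  D = λ q → prime? q ×-dec q ∣? m

primesUpTo-dividing : ∀ {m q} → q ≤ m → (∀ p → Prime p → p ∣ m → p ≤ q) →
  filter (_∣? m) (primesUpTo q) ≡ primeDivisors m
primesUpTo-dividing {m} {q} q≤m maximal = begin
  filter (_∣? m) (filter prime? (interval 1 q))             ≡⟨ filter-filter prime? (_∣? m) (interval 1 q) ⟩
  filter D (interval 1 q)                                   ≡⟨ cong (filter D) (interval≡range 1 q) ⟩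
  filter D (range 1 q)                                      ≡⟨ ++-identityʳ (filter D (range 1 q)) ⟨
  filter D (range 1 q) ++ []                                ≡⟨ cong (filter D (range 1 q) ++_) (filter-none D beyond-q) ⟨
  filter D (range 1 q) ++ filter D (range (1 + q) (m ∸ q))  ≡⟨ filter-++ D (range 1 q) (range (1 + q) (m ∸ q)) ⟨
  filter D (range 1 q ++ range (1 + q) (m ∸ q))             ≡⟨ cong (filter D) (range-++ 1 q (m ∸ q)) ⟨
  filter D (range 1 (q + (m ∸ q)))                          ≡⟨ cong (λ k → filter D (range 1 k)) (m+[n∸m]≡n q≤m) ⟩
  filter D (range 1 m)                                      ≡⟨ cong (filter D) (interval≡range 1 m) ⟨
  primeDivisors m                                           ∎
  where
  open ≡-Reasoning
  D = λ p → prime? p ×-dec p ∣? m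
  beyond-q : All (λ p → ¬ (Prime p × p ∣ m)) (range (1 + q) (m ∸ q))
  beyond-q = All.tabulate λ p∈ (pp , p∣m) → <⇒≱ (proj₁ (∈-range⁻ (1 + q) (m ∸ q) p∈)) (maximal _ pp p∣m)

primesUpTo-not-dividing : ∀ {m q} → 1 ≤ m → q ∣ m →
  filter (¬? ∘ (_∣? m)) (primesUpTo q) ≡ filter (λ p → prime? p ×-dec ¬? (p ∣? radical m)) (interval 1 (q ∸ 1))
primesUpTo-not-dividing {m} {zero} m≥1 0∣m with 0∣⇒≡0 0∣m | m≥1
... | refl | ()
primesUpTo-not-dividing {m} {suc q-1} m≥1 q∣m = begin
  filter (¬? ∘ (_∣? m)) (filter prime? (interval 1 q))      ≡⟨ filter-filter prime? (¬? ∘ (_∣? m)) (interval 1 q) ⟩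
  filter E (interval 1 q)                                   ≡⟨ cong (filter E) (trans (interval≡range 1 q) (range-∷ʳ 1 q-1)) ⟩
  filter E (range 1 q-1 ∷ʳ q)                               ≡⟨ filter-++ E (range 1 q-1) (q ∷ []) ⟩
  filter E (range 1 q-1) ++ filter E (q ∷ [])               ≡⟨ cong (filter E (range 1 q-1) ++_) (filter-none E ((λ (_ , q∤m) → q∤m q∣m) ∷ [])) ⟩
  filter E (range 1 q-1) ++ []                              ≡⟨ ++-identityʳ (filter E (range 1 q-1)) ⟩
  filter E (range 1 q-1)                                    ≡⟨ filter-≐ E E′ ((λ (pp , p∤m) → pp , p∤m ∘ to (prime∣radical⇔prime∣ m≥1 pp))
                                                                            , (λ (pp , p∤Q) → pp , p∤Q ∘ from (prime∣radical⇔prime∣ m≥1 pp)))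
                                                                          (range 1 q-1) ⟩
  filter E′ (range 1 q-1)                                   ≡⟨ cong (filter E′) (interval≡range 1 q-1) ⟨
  filter E′ (interval 1 (q ∸ 1))                            ∎
  where
  open ≡-Reasoning
  open Equivalence
  q = suc q-1
  E = λ p → prime? p ×-dec ¬? (p ∣? m)
  E′ = λ p → prime? p ×-dec ¬? (p ∣? radical m)

admissible-∣ : ∀ {g p} → p ∣ g → admissible g p ≡ p ∸ 1
admissible-∣ {g} {p} p∣g = cong (λ b → if b then p ∸ 1 else p ∸ 2) (dec-true (p ∣? g) p∣g)

admissible-∤ : ∀ {g p} → ¬ p ∣ g → admissible g p ≡ p ∸ 2
admissible-∤ {g} {p} p∤g = cong (λ b → if b then p ∸ 1 else p ∸ 2) (dec-false (p ∣? g) p∤g)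

admissible-pos : ∀ {g p} → 2 ∣ g → Prime p → 1 ≤ admissible g p
admissible-pos {g} {p} 2∣g pp with p ∣? g
... | yes _   = ∸-monoˡ-≤ 1 (prime≥2 pp)
... | no  p∤g with m≤n⇒m<n∨m≡n (prime≥2 pp)
...   | inj₁ 2<p  = ∸-monoˡ-≤ 2 2<p
...   | inj₂ refl = ⊥-elim (p∤g 2∣g)

pairCount-primorial : ∀ {g q} → 1 ≤ g → q ∣ g → (∀ p → Prime p → p ∣ g → p ≤ q) →
  pairCount (q #) g ≡ φ (radical g) * oddFactor q (radical g)
pairCount-primorial {g} {q} g≥1 q∣g maximal = begin
  pairCount (q #) g                                       ≡⟨ pairCount-product (primesUpTo-prime q) (primesUpTo-increasing q) g ⟩
  product (map (admissible g) ps)                         ≡⟨ product-map-partition (_∣? g) (admissible g) ps ⟩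
  product (map (admissible g) (filter (_∣? g) ps)) * product (map (admissible g) (filter (¬? ∘ (_∣? g)) ps))
                                                          ≡⟨ cong₂ _*_ dividing-part coprime-part ⟩
  φ (radical g) * oddFactor q (radical g)                 ∎
  where
  open ≡-Reasoning
  ps = primesUpTo q
  dividing-part : product (map (admissible g) (filter (_∣? g) ps)) ≡ φ (radical g)
  dividing-part = begin
    product (map (admissible g) (filter (_∣? g) ps))      ≡⟨ cong (product ∘ map (admissible g)) (primesUpTo-dividing (∣⇒≤ {{>-nonZero g≥1}} q∣g) maximal) ⟩
    product (map (admissible g) (primeDivisors g))        ≡⟨ cong product (map-cong-local (All.tabulate λ {p} p∈ →
                                                              let p∣g = proj₂ (proj₂ (∈-filter⁻ (λ p → prime? p ×-dec p ∣? g) {xs = interval 1 g} p∈))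
                                                              in trans (admissible-∣ p∣g) (sym (admissible-∣ (p ∣0))))) ⟩
    product (map (admissible 0) (primeDivisors g))        ≡⟨ pairCount-product (primeDivisors-prime g) (primeDivisors-increasing g) 0 ⟨
    pairCount (radical g) 0                               ≡⟨ φ≡pairCount (productOfPrimes≥1 (primeDivisors-prime g)) ⟨
    φ (radical g)                                         ∎
  coprime-part : product (map (admissible g) (filter (¬? ∘ (_∣? g)) ps)) ≡ oddFactor q (radical g)
  coprime-part = cong product (begin
    map (admissible g) (filter (¬? ∘ (_∣? g)) ps)         ≡⟨ map-cong-local (All.tabulate λ p∈ →
                                                               admissible-∤ (proj₂ (∈-filter⁻ (¬? ∘ (_∣? g)) {xs = ps} p∈))) ⟩
    map (_∸ 2) (filter (¬? ∘ (_∣? g)) ps)                 ≡⟨ cong (map (_∸ 2)) (primesUpTo-not-dividing g≥1 q∣g) ⟩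
    map (_∸ 2) (filter (λ p → prime? p ×-dec ¬? (p ∣? radical g)) (interval 1 (q ∸ 1))) ∎)

pairCount-primorial-pos : ∀ {g} q → 2 ∣ g → 1 ≤ pairCount (q #) g
pairCount-primorial-pos {g} q 2∣g =
  subst (1 ≤_) (sym (pairCount-product (primesUpTo-prime q) (primesUpTo-increasing q) g))
    (product-map-pos (admissible g) (primesUpTo q) (admissible-pos 2∣g ∘ All.lookup (primesUpTo-prime q)))

partialDrivingSum-pos⇒drivingTerm : ∀ {g N J} → 1 ≤ partialDrivingSum g N J → ∃[ j ] (1 ≤ j × 1 ≤ drivingCount g j N)
partialDrivingSum-pos⇒drivingTerm {g} {N} {J} pos
  with ∑-pos⇒∃ (range 1 J) (λ j → drivingCount g j N)
         (subst (1 ≤_) (trans (sum-map≡∑ (λ j → drivingCount g j N) (interval 1 J))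
                              (cong (λ js → ∑ js (λ j → drivingCount g j N)) (interval≡range 1 J))) pos)
... | j , j∈ , count≥1 = j , proj₁ (∈-range⁻ 1 J j∈) , count≥1

mainTheorem11 : (n : ℕ) → 1 ≤ n →
    (qb : ℕ) → Prime qb → qb ∣ 2 * n → (∀ p → Prime p → p ∣ 2 * n → p ≤ qb) →
    (∃[ J ] (∀ J′ → J′ ≥ J →
        partialDrivingSum (2 * n) (qb #) J′ ≡ φ (radical (2 * n)) * oddFactor qb (radical (2 * n))))
    × (∃[ j ] (1 ≤ j × 1 ≤ drivingCount (2 * n) j (qb #)))
mainTheorem11 n n≥1 qb _ qb∣2n maximal = (2 * n , stable) , partialDrivingSum-pos⇒drivingTerm {2 * n} {qb #} {2 * n} positive
  where
  2n≥1 : 1 ≤ 2 * n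
  2n≥1 = *-mono-≤ {1} {2} (s≤s z≤n) n≥1
  N≥1 : 1 ≤ qb #
  N≥1 = productOfPrimes≥1 (primesUpTo-prime qb)
  stable : ∀ J → J ≥ 2 * n → partialDrivingSum (2 * n) (qb #) J ≡ φ (radical (2 * n)) * oddFactor qb (radical (2 * n))
  stable J J≥2n = trans (partialDrivingSum-stable N≥1 2n≥1 J≥2n) (pairCount-primorial 2n≥1 qb∣2n maximal)
  positive : 1 ≤ partialDrivingSum (2 * n) (qb #) (2 * n)
  positive = subst (1 ≤_) (sym (partialDrivingSum-stable N≥1 2n≥1 ≤-refl)) (pairCount-primorial-pos qb (m∣m*n n))
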